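{- For integers $m\ge 1$, define the incomplete Lehmer-Euler numbers $W_{n,\le m}$ and $W_{n,\ge m}$ by $$\sum_{n=0}^\infty W_{n,\le m}\frac{t^n}{n!}=\frac{1}{1+\sum_{l=1}^m\frac{t^{3l}}{(3l)!}},\qquad \sum_{n=0}^\infty W_{n,\ge m}\frac{t^n}{n!}=\frac{1}{1+\sum_{l=m}^\infty\frac{t^{3l}}{(3l)!}}.$$ Then for $n\ge m\ge 1$, $$W_{3n,\le m}=(3n)!\sum_{\substack{t_1+2t_2+\cdots+mt_m=n\\ t_1,\dots,t_m\ge0}}\binom{t_1+\cdots+t_m}{t_1,\dots,t_m}\prod_{l=1}^{m}\left(\frac{ -1}{(3l)!}\right)^{t_l}$$ and $$W_{3n,\ge m}=(3n)!\sum_{\substack{mt_m+(m+1)t_{m+1}+\cdots+nt_n=n\\ t_m,\dots,t_n\ge0}}\binom{t_m+t_{m+1}+\cdots+t_n}{t_m,t_{m+1},\dots,t_n}\prod_{l=m}^{n}\left(\frac{ -1}{(3l)!}\right)^{t_l}.$$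
   Context: $\binom{t_1+\cdots+t_m}{t_1,\dots,t_m}$ denotes the multinomial coefficient. -}

module Defs where

open import Data.Nat as ℕ using (ℕ; zero; suc; _≡ᵇ_; _!; _∸_)
open import Data.Nat.Properties using (_!≢0)
open import Data.Nat.Combinatorics using (_C_)
open import Data.Integer using (+_)
open import Data.Rational using (ℚ; 0ℚ; 1ℚ; _+_; _*_; -_; _/_)
open import Data.List using (List; []; _∷_; map; concatMap; upTo; zipWith; foldr; length)
open import Data.Nat.ListAction using (sum)
open import Data.Bool using (Bool; true; false; if_then_else_; _∧_; _∨_)

ℕ→ℚ : ℕ → ℚ
ℕ→ℚ n = + n / 1

inv! : ℕ → ℚ
inv! k = (+ 1 / (k !)) {{k !≢0}}

pow : ℚ → ℕ → ℚ
pow p zero = 1ℚ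
pow p (suc k) = p * pow p k

sumℚ : List ℚ → ℚ
sumℚ = foldr _+_ 0ℚ

productℚ : List ℚ → ℚ
productℚ = foldr _*_ 1ℚ

-- invRev d n = [a_n , a_{n-1} , … , a_0] where Σ a_n tⁿ = 1 / Σ d_n tⁿ,
-- assuming d_0 = 1:  a_0 = 1,  a_n = - Σ_{k=1}^{n} d_k a_{n-k}.
invRev : (ℕ → ℚ) → ℕ → List ℚ
invRev d zero = 1ℚ ∷ []
invRev d (suc n) = new ∷ prev
  where
  prev = invRev d n
  go : ℕ → List ℚ → ℚ
  go i [] = 0ℚ
  go i (x ∷ xs) = d (suc i) * x + go (suc i) xs
  new = - go 0 prev

head0 : List ℚ → ℚ
head0 [] = 0ℚ
head0 (x ∷ _) = x

invCoeff : (ℕ → ℚ) → ℕ → ℚ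
invCoeff d n = head0 (invRev d n)

inLe : ℕ → ℕ → Bool
inLe m l = (1 ℕ.≤ᵇ l) ∧ (l ℕ.≤ᵇ m)

inGe : ℕ → ℕ → Bool          -- l ≥ m  (m ≥ 1 assumed in the theorem)
inGe m l = (m ℕ.≤ᵇ l) ∧ (1 ℕ.≤ᵇ l)

-- coefficients of 1 + Σ_{l ∈ S} t^{3l}/(3l)!
denCoeff : (ℕ → Bool) → ℕ → ℚ
denCoeff S zero = 1ℚ
denCoeff S j@(suc _) =
  if (j ℕ.% 3 ≡ᵇ 0) ∧ S (j ℕ./ 3) then inv! j else 0ℚ

W≤ : ℕ → ℕ → ℚ
W≤ m n = ℕ→ℚ (n !) * invCoeff (denCoeff (inLe m)) n

W≥ : ℕ → ℕ → ℚ
W≥ m n = ℕ→ℚ (n !) * invCoeff (denCoeff (inGe m)) n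

multinomial : List ℕ → ℕ
multinomial [] = 1
multinomial (t ∷ ts) = ((t ℕ.+ sum ts) C t) ℕ.* multinomial ts

tuples : ℕ → ℕ → List (List ℕ)
tuples zero b = [] ∷ []
tuples (suc k) b = concatMap (λ x → map (x ∷_) (tuples k b)) (upTo (suc b))

weight : List ℕ → List ℕ → ℕ
weight ls ts = sum (zipWith ℕ._*_ ls ts)

termProd : List ℕ → List ℕ → ℚ
termProd ls ts = productℚ (zipWith (λ l t → pow (- inv! (3 ℕ.* l)) t) ls ts)

-- Σ over (t_l)_{l ∈ ls}, t_l ≥ 0, with Σ l t_l = n, of
--   multinomial(t) · Π_{l ∈ ls} (-1/(3l)!)^{t_l}
-- (all indices l are ≥ 1, so each t_l ≤ n and enumerating {0,…,n} is exhaustive)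
compSum : List ℕ → ℕ → ℚ
compSum ls n = sumℚ (map summand (tuples (length ls) n))
  where
  summand : List ℕ → ℚ
  summand ts = if weight ls ts ≡ᵇ n
               then ℕ→ℚ (multinomial ts) * termProd ls ts
               else 0ℚ

range : ℕ → ℕ → List ℕ
range a b = map (a ℕ.+_) (upTo (suc b ∸ a))

{-# OPTIONS --safe #-}
-- The denominators are 1 - Q(t³) with Q(u) = Σ_{l ∈ L} -u^l/(3l)!, where L = {1,…,m}
-- resp. {m, m+1, …}; for the coefficient of t^{3n} only l ≤ n matter, so L may be cut to
-- {m,…,n}. As the denominator involves only powers of t³, its reciprocal is (1/(1 - Q))(t³),
-- and 1/(1 - Q) = Σ_s Q^s. By the multinomial theorem the coefficient of u^n in Q^s is the sum
-- over (t_l) with Σ t_l = s and Σ l t_l = n of the multinomial coefficient times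
-- Π (-1/(3l)!)^{t_l}. Formally both sides are identified through the recurrence determining
-- the coefficients of a reciprocal series; for Σ_s Q^s it follows from Q^{s+1} = Q · Q^s, where
-- Q^s is expanded by the binomial theorem in the first monomial of Q and the step is Pascal's rule.
module Submission where

open import Defs
open import Data.Nat using (ℕ; _≤_; _*_; _!)
open import Data.Product using (_×_)
open import Relation.Binary.PropositionalEquality using (_≡_)
import Data.Rational as ℚ

open import Data.Bool using (Bool; true; false; if_then_else_; _∧_)
open import Data.Bool.Properties using (∧-identityʳ)
import Data.Integer as ℤ
import Data.Integer.Properties as ℤ
open import Data.List using (List; []; _∷_; map; concatMap; applyUpTo; upTo; length; zipWith; _++_)
open import Data.List.Properties using (map-∘; map-cong; map-cong-local; map-applyUpTo)
open import Data.List.Relation.Unary.All as All using (All; []; _∷_)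
import Data.List.Relation.Unary.All.Properties as All
open import Data.Nat as ℕ using (zero; suc; _<_; _∸_; _≡ᵇ_; _≤ᵇ_; _≤?_; z≤n; s≤s)
import Data.Nat.Properties as ℕ
open import Data.Nat.Combinatorics using (_C_; k>n⇒nCk≡0; nCk+nC[k+1]≡[n+1]C[k+1])
open import Data.Nat.DivMod using (_%_; _/_; m*n%n≡0; m*n/n≡m)
open import Data.Nat.Divisibility using (_∣_; _∤_; _∣0; ∣-refl; ∣m+n∣m⇒∣n; >⇒∤; m%n≡0⇒n∣m)
open import Data.Nat.ListAction using (sum)
open import Data.Product using (_,_)
open import Data.Rational using (ℚ; 0ℚ; 1ℚ; _+_; -_; toℚᵘ) renaming (_*_ to _·_)
import Data.Rational.Properties as ℚ
open import Data.Rational.Solver using (module +-*-Solver)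
import Data.Rational.Unnormalised as ℚᵘ
import Data.Rational.Unnormalised.Properties as ℚᵘ
open import Data.Sum using (inj₁; inj₂)
open import Data.Unit using (tt)
open import Function using (_∘_)
open import Relation.Binary.PropositionalEquality using (_≢_; refl; sym; trans; cong; cong₂; subst; module ≡-Reasoning)
open import Relation.Nullary using (yes; no)
open import Relation.Nullary.Negation using (contradiction)
open import Relation.Nullary.Reflects using (Reflects; ofʸ; ofⁿ)
open import Algebra.Properties.Group ℚ.+-0-group using (⁻¹-involutive)

open +-*-Solver using (solve; _:+_; _:*_; _:=_; con)
open ≡-Reasoning

toℚᵘ-ℕ→ℚ : ∀ n → toℚᵘ (ℕ→ℚ n) ℚᵘ.≃ ℚᵘ.mkℚᵘ (ℤ.+ n) 0
toℚᵘ-ℕ→ℚ n = ℚ.toℚᵘ-fromℚᵘ (ℚᵘ.mkℚᵘ (ℤ.+ n) 0)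

ℕ→ℚ-suc : ∀ n → ℕ→ℚ (suc n) ≡ 1ℚ + ℕ→ℚ n
ℕ→ℚ-suc n = ℚ.toℚᵘ-injective
  (ℚᵘ.≃-trans (toℚᵘ-ℕ→ℚ (suc n))
  (ℚᵘ.≃-trans (ℚᵘ.*≡* (cong (ℤ._* ℤ.+ 1) (cong (ℤ._+_ ℤ.1ℤ) (sym (ℤ.*-identityʳ (ℤ.+ n))))))
  (ℚᵘ.≃-sym (ℚᵘ.≃-trans (ℚ.toℚᵘ-homo-+ 1ℚ (ℕ→ℚ n)) (ℚᵘ.+-congʳ ℚᵘ.1ℚᵘ (toℚᵘ-ℕ→ℚ n))))))

ℕ→ℚ-homo-+ : ∀ a b → ℕ→ℚ (a ℕ.+ b) ≡ ℕ→ℚ a + ℕ→ℚ b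
ℕ→ℚ-homo-+ zero    b = sym (ℚ.+-identityˡ (ℕ→ℚ b))
ℕ→ℚ-homo-+ (suc a) b = begin
  ℕ→ℚ (suc (a ℕ.+ b))    ≡⟨ ℕ→ℚ-suc (a ℕ.+ b) ⟩
  1ℚ + ℕ→ℚ (a ℕ.+ b)     ≡⟨ cong (1ℚ +_) (ℕ→ℚ-homo-+ a b) ⟩
  1ℚ + (ℕ→ℚ a + ℕ→ℚ b)   ≡⟨ sym (ℚ.+-assoc 1ℚ (ℕ→ℚ a) (ℕ→ℚ b)) ⟩
  1ℚ + ℕ→ℚ a + ℕ→ℚ b     ≡⟨ cong (_+ ℕ→ℚ b) (sym (ℕ→ℚ-suc a)) ⟩
  ℕ→ℚ (suc a) + ℕ→ℚ b    ∎

ℕ→ℚ-homo-* : ∀ a b → ℕ→ℚ (a * b) ≡ ℕ→ℚ a · ℕ→ℚ b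
ℕ→ℚ-homo-* zero    b = sym (ℚ.*-zeroˡ (ℕ→ℚ b))
ℕ→ℚ-homo-* (suc a) b = begin
  ℕ→ℚ (b ℕ.+ a * b)             ≡⟨ ℕ→ℚ-homo-+ b (a * b) ⟩
  ℕ→ℚ b + ℕ→ℚ (a * b)           ≡⟨ cong (ℕ→ℚ b +_) (ℕ→ℚ-homo-* a b) ⟩
  ℕ→ℚ b + ℕ→ℚ a · ℕ→ℚ b
    ≡⟨ solve 2 (λ a b → b :+ a :* b := (con 1ℚ :+ a) :* b) refl (ℕ→ℚ a) (ℕ→ℚ b) ⟩
  (1ℚ + ℕ→ℚ a) · ℕ→ℚ b          ≡⟨ cong (_· ℕ→ℚ b) (sym (ℕ→ℚ-suc a)) ⟩
  ℕ→ℚ (suc a) · ℕ→ℚ b           ∎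

-- Finite sums

∑ : ℕ → (ℕ → ℚ) → ℚ
∑ zero    f = 0ℚ
∑ (suc n) f = f 0 + ∑ n (f ∘ suc)

∑-cong : ∀ n {f g : ℕ → ℚ} → (∀ i → i < n → f i ≡ g i) → ∑ n f ≡ ∑ n g
∑-cong zero    eq = refl
∑-cong (suc n) eq = cong₂ _+_ (eq 0 (s≤s z≤n)) (∑-cong n (λ i i<n → eq (suc i) (s≤s i<n)))

∑-zero : ∀ n {f : ℕ → ℚ} → (∀ i → i < n → f i ≡ 0ℚ) → ∑ n f ≡ 0ℚ
∑-zero zero    eq = refl
∑-zero (suc n) eq = cong₂ _+_ (eq 0 (s≤s z≤n)) (∑-zero n (λ i i<n → eq (suc i) (s≤s i<n)))

∑-+ : ∀ n (f g : ℕ → ℚ) → ∑ n (λ i → f i + g i) ≡ ∑ n f + ∑ n g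
∑-+ zero    f g = refl
∑-+ (suc n) f g = trans (cong (f 0 + g 0 +_) (∑-+ n (f ∘ suc) (g ∘ suc)))
  (solve 4 (λ a b c d → (a :+ b) :+ (c :+ d) := (a :+ c) :+ (b :+ d)) refl
    (f 0) (g 0) (∑ n (f ∘ suc)) (∑ n (g ∘ suc)))

∑-*ˡ : ∀ n c (f : ℕ → ℚ) → ∑ n (λ i → c · f i) ≡ c · ∑ n f
∑-*ˡ zero    c f = sym (ℚ.*-zeroʳ c)
∑-*ˡ (suc n) c f = trans (cong (c · f 0 +_) (∑-*ˡ n c (f ∘ suc)))
  (sym (ℚ.*-distribˡ-+ c (f 0) (∑ n (f ∘ suc))))

∑-neg : ∀ n (f : ℕ → ℚ) → ∑ n (λ i → - f i) ≡ - ∑ n f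
∑-neg zero    f = refl
∑-neg (suc n) f = trans (cong (- f 0 +_) (∑-neg n (f ∘ suc)))
  (sym (ℚ.neg-distrib-+ (f 0) (∑ n (f ∘ suc))))

∑-snoc : ∀ n (f : ℕ → ℚ) → ∑ (suc n) f ≡ ∑ n f + f n
∑-snoc zero    f = trans (ℚ.+-identityʳ (f 0)) (sym (ℚ.+-identityˡ (f 0)))
∑-snoc (suc n) f = trans (cong (f 0 +_) (∑-snoc n (f ∘ suc)))
  (sym (ℚ.+-assoc (f 0) (∑ n (f ∘ suc)) (f (suc n))))

∑-split : ∀ m n (f : ℕ → ℚ) → ∑ (m ℕ.+ n) f ≡ ∑ m f + ∑ n (λ i → f (m ℕ.+ i))
∑-split zero    n f = sym (ℚ.+-identityˡ (∑ n f))
∑-split (suc m) n f = trans (cong (f 0 +_) (∑-split m n (f ∘ suc)))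
  (sym (ℚ.+-assoc (f 0) (∑ m (f ∘ suc)) (∑ n (λ i → f (suc m ℕ.+ i)))))

∑-extend : ∀ {m n} {f : ℕ → ℚ} → m ≤ n → (∀ i → m ≤ i → f i ≡ 0ℚ) → ∑ n f ≡ ∑ m f
∑-extend {m} {n} {f} m≤n vanish = begin
  ∑ n f                                     ≡⟨ cong (λ k → ∑ k f) (sym (ℕ.m+[n∸m]≡n m≤n)) ⟩
  ∑ (m ℕ.+ (n ∸ m)) f                       ≡⟨ ∑-split m (n ∸ m) f ⟩
  ∑ m f + ∑ (n ∸ m) (λ i → f (m ℕ.+ i))
    ≡⟨ cong (∑ m f +_) (∑-zero (n ∸ m) (λ i _ → vanish (m ℕ.+ i) (ℕ.m≤m+n m i))) ⟩
  ∑ m f + 0ℚ                                ≡⟨ ℚ.+-identityʳ (∑ m f) ⟩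
  ∑ m f                                     ∎

∑-sparse : ∀ k q (f : ℕ → ℚ) → (∀ i → suc k ∤ suc i → f i ≡ 0ℚ) →
           ∑ (q * suc k) f ≡ ∑ q (λ p → f (p * suc k ℕ.+ k))
∑-sparse k zero    f sparse = refl
∑-sparse k (suc q) f sparse = begin
  ∑ (suc k ℕ.+ q * suc k) f                                ≡⟨ ∑-split (suc k) (q * suc k) f ⟩
  ∑ (suc k) f + ∑ (q * suc k) (λ i → f (suc k ℕ.+ i))      ≡⟨ cong₂ _+_ first-block (∑-sparse k q _ shifted) ⟩
  f k + ∑ q (λ p → f (suc k ℕ.+ (p * suc k ℕ.+ k)))
    ≡⟨ cong (f k +_) (∑-cong q (λ p _ → cong f (sym (ℕ.+-assoc (suc k) (p * suc k) k)))) ⟩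
  f k + ∑ q (λ p → f (suc p * suc k ℕ.+ k))                ∎
  where
  first-block : ∑ (suc k) f ≡ f k
  first-block = begin
    ∑ (suc k) f    ≡⟨ ∑-snoc k f ⟩
    ∑ k f + f k    ≡⟨ cong (_+ f k) (∑-zero k (λ i i<k → sparse i (>⇒∤ (s≤s i<k)))) ⟩
    0ℚ + f k       ≡⟨ ℚ.+-identityˡ (f k) ⟩
    f k            ∎
  shifted : ∀ i → suc k ∤ suc i → f (suc k ℕ.+ i) ≡ 0ℚ
  shifted i k∤ = sparse (suc k ℕ.+ i) (λ k∣ → k∤ (∣m+n∣m⇒∣n (subst (suc k ∣_) (sym (ℕ.+-suc (suc k) i)) k∣) ∣-refl))

sumℚ-++ : ∀ {A : Set} (f : A → ℚ) xs ys → sumℚ (map f (xs ++ ys)) ≡ sumℚ (map f xs) + sumℚ (map f ys)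
sumℚ-++ f []       ys = sym (ℚ.+-identityˡ (sumℚ (map f ys)))
sumℚ-++ f (x ∷ xs) ys = trans (cong (f x +_) (sumℚ-++ f xs ys))
  (sym (ℚ.+-assoc (f x) (sumℚ (map f xs)) (sumℚ (map f ys))))

sumℚ-concatMap : ∀ {A B : Set} (f : B → ℚ) (g : A → List B) xs →
                 sumℚ (map f (concatMap g xs)) ≡ sumℚ (map (λ x → sumℚ (map f (g x))) xs)
sumℚ-concatMap f g []       = refl
sumℚ-concatMap f g (x ∷ xs) = trans (sumℚ-++ f (g x) (concatMap g xs))
  (cong (sumℚ (map f (g x)) +_) (sumℚ-concatMap f g xs))

sumℚ-applyUpTo : ∀ (f : ℕ → ℚ) n → sumℚ (applyUpTo f n) ≡ ∑ n f
sumℚ-applyUpTo f zero    = refl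
sumℚ-applyUpTo f (suc n) = cong (f 0 +_) (sumℚ-applyUpTo (f ∘ suc) n)

sumℚ-upTo : ∀ (f : ℕ → ℚ) n → sumℚ (map f (upTo n)) ≡ ∑ n f
sumℚ-upTo f n = trans (cong sumℚ (map-applyUpTo (λ i → i) f n)) (sumℚ-applyUpTo f n)

sumℚ-range : ∀ (f : ℕ → ℚ) a b → sumℚ (map f (range a b)) ≡ ∑ (suc b ∸ a) (λ i → f (a ℕ.+ i))
sumℚ-range f a b = trans (cong sumℚ (sym (map-∘ (upTo (suc b ∸ a))))) (sumℚ-upTo (f ∘ (a ℕ.+_)) (suc b ∸ a))

sumℚ-zero : ∀ {A : Set} (xs : List A) → sumℚ (map (λ _ → 0ℚ) xs) ≡ 0ℚ
sumℚ-zero []       = refl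
sumℚ-zero (x ∷ xs) = cong (0ℚ +_) (sumℚ-zero xs)

sumℚ-*ˡ : ∀ {A : Set} c (f : A → ℚ) xs → sumℚ (map (λ x → c · f x) xs) ≡ c · sumℚ (map f xs)
sumℚ-*ˡ c f []       = sym (ℚ.*-zeroʳ c)
sumℚ-*ˡ c f (x ∷ xs) = trans (cong (c · f x +_) (sumℚ-*ˡ c f xs))
  (sym (ℚ.*-distribˡ-+ c (f x) (sumℚ (map f xs))))

sumℚ-*ʳ : ∀ {A : Set} c (f : A → ℚ) xs → sumℚ (map (λ x → f x · c) xs) ≡ sumℚ (map f xs) · c
sumℚ-*ʳ c f xs = begin
  sumℚ (map (λ x → f x · c) xs)   ≡⟨ cong sumℚ (map-cong (λ x → ℚ.*-comm (f x) c) xs) ⟩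
  sumℚ (map (λ x → c · f x) xs)   ≡⟨ sumℚ-*ˡ c f xs ⟩
  c · sumℚ (map f xs)             ≡⟨ ℚ.*-comm c _ ⟩
  sumℚ (map f xs) · c             ∎

∑-sumℚ : ∀ {A : Set} n (F : ℕ → A → ℚ) xs →
         ∑ n (λ i → sumℚ (map (F i) xs)) ≡ sumℚ (map (λ x → ∑ n (λ i → F i x)) xs)
∑-sumℚ n F []       = ∑-zero n (λ _ _ → refl)
∑-sumℚ n F (x ∷ xs) = trans (∑-+ n (λ i → F i x) (λ i → sumℚ (map (F i) xs)))
  (cong (∑ n (λ i → F i x) +_) (∑-sumℚ n F xs))

-- Formal power series in u as coefficient sequences: δ i is u^i, shift k f is u^k · f and
-- conv is the Cauchy product.

δ : ℕ → ℕ → ℚ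
δ zero    zero    = 1ℚ
δ zero    (suc _) = 0ℚ
δ (suc _) zero    = 0ℚ
δ (suc i) (suc j) = δ i j

shift : ℕ → (ℕ → ℚ) → ℕ → ℚ
shift zero    f n       = f n
shift (suc k) f zero    = 0ℚ
shift (suc k) f (suc n) = shift k f n

conv : (ℕ → ℚ) → (ℕ → ℚ) → ℕ → ℚ
conv f g n = ∑ (suc n) (λ k → f k · g (n ∸ k))

δ-≢ : ∀ {i j} → i ≢ j → δ i j ≡ 0ℚ
δ-≢ {zero}  {zero}  i≢j = contradiction refl i≢j
δ-≢ {zero}  {suc j} i≢j = refl
δ-≢ {suc i} {zero}  i≢j = refl
δ-≢ {suc i} {suc j} i≢j = δ-≢ (i≢j ∘ cong suc)

δ-cancel : ∀ a i j → δ (a ℕ.+ i) (a ℕ.+ j) ≡ δ i j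
δ-cancel zero    i j = refl
δ-cancel (suc a) i j = δ-cancel a i j

δ-subst : ∀ i j (f : ℕ → ℚ) → δ i j · f j ≡ δ i j · f i
δ-subst zero    zero    f = refl
δ-subst zero    (suc j) f = trans (ℚ.*-zeroˡ (f (suc j))) (sym (ℚ.*-zeroˡ (f 0)))
δ-subst (suc i) zero    f = trans (ℚ.*-zeroˡ (f 0)) (sym (ℚ.*-zeroˡ (f (suc i))))
δ-subst (suc i) (suc j) f = δ-subst i j (f ∘ suc)

∑-δ : ∀ N j (g : ℕ → ℚ) → j < N → ∑ N (λ i → δ i j · g i) ≡ g j
∑-δ (suc N) zero    g _ = begin
  1ℚ · g 0 + ∑ N (λ i → 0ℚ · g (suc i))  ≡⟨ cong₂ _+_ (ℚ.*-identityˡ (g 0)) (∑-zero N (λ i _ → ℚ.*-zeroˡ (g (suc i)))) ⟩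
  g 0 + 0ℚ                               ≡⟨ ℚ.+-identityʳ (g 0) ⟩
  g 0                                    ∎
∑-δ (suc N) (suc j) g (s≤s j<N) = begin
  0ℚ · g 0 + ∑ N (λ i → δ i j · g (suc i))  ≡⟨ cong (_+ ∑ N (λ i → δ i j · g (suc i))) (ℚ.*-zeroˡ (g 0)) ⟩
  0ℚ + ∑ N (λ i → δ i j · g (suc i))        ≡⟨ ℚ.+-identityˡ _ ⟩
  ∑ N (λ i → δ i j · g (suc i))             ≡⟨ ∑-δ N j (g ∘ suc) j<N ⟩
  g (suc j)                                 ∎

∑-δ-miss : ∀ N j (g : ℕ → ℚ) → N ≤ j → ∑ N (λ i → δ i j · g i) ≡ 0ℚ
∑-δ-miss N j g N≤j = ∑-zero N (λ i i<N →
  trans (cong (_· g i) (δ-≢ (ℕ.<⇒≢ (ℕ.<-≤-trans i<N N≤j)))) (ℚ.*-zeroˡ (g i)))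

shift-+ : ∀ a b (f : ℕ → ℚ) n → shift (a ℕ.+ b) f n ≡ shift a (shift b f) n
shift-+ zero    b f n       = refl
shift-+ (suc a) b f zero    = refl
shift-+ (suc a) b f (suc n) = shift-+ a b f n

shift-comm : ∀ a b (f : ℕ → ℚ) n → shift a (shift b f) n ≡ shift b (shift a f) n
shift-comm a b f n = begin
  shift a (shift b f) n    ≡⟨ sym (shift-+ a b f n) ⟩
  shift (a ℕ.+ b) f n      ≡⟨ cong (λ k → shift k f n) (ℕ.+-comm a b) ⟩
  shift (b ℕ.+ a) f n      ≡⟨ shift-+ b a f n ⟩
  shift b (shift a f) n    ∎

shift-below : ∀ {k n} (f : ℕ → ℚ) → n < k → shift k f n ≡ 0ℚ
shift-below {suc k} {zero}  f _         = refl
shift-below {suc k} {suc n} f (s≤s n<k) = shift-below f n<k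

shift-vanish : ∀ k {c n} {f : ℕ → ℚ} → (∀ m → m < c → f m ≡ 0ℚ) → n < k ℕ.+ c → shift k f n ≡ 0ℚ
shift-vanish zero    {n = n}     vanish n<c         = vanish n n<c
shift-vanish (suc k) {n = zero}  vanish _           = refl
shift-vanish (suc k) {n = suc n} vanish (s≤s n<k+c) = shift-vanish k vanish n<k+c

shift-cong : ∀ k {n} {f g : ℕ → ℚ} → (∀ m → m ≤ n → f m ≡ g m) → shift k f n ≡ shift k g n
shift-cong zero    {n}     eq = eq n ℕ.≤-refl
shift-cong (suc k) {zero}  eq = refl
shift-cong (suc k) {suc n} eq = shift-cong k (λ m m≤n → eq m (ℕ.m≤n⇒m≤1+n m≤n))

shift-if : ∀ k w n (A : ℚ) → shift k (λ m → if w ≡ᵇ m then A else 0ℚ) n ≡ (if k ℕ.+ w ≡ᵇ n then A else 0ℚ)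
shift-if zero    w n       A = refl
shift-if (suc k) w zero    A = refl
shift-if (suc k) w (suc n) A = shift-if k w n A

shift-commute : ∀ {A : Set} (Φ : (A → ℚ) → ℚ) → Φ (λ _ → 0ℚ) ≡ 0ℚ →
                ∀ k (F : A → ℕ → ℚ) n → shift k (λ m → Φ (λ a → F a m)) n ≡ Φ (λ a → shift k (F a) n)
shift-commute Φ Φ0 zero    F n       = refl
shift-commute Φ Φ0 (suc k) F zero    = sym Φ0
shift-commute Φ Φ0 (suc k) F (suc n) = shift-commute Φ Φ0 k F n

shift-*ˡ : ∀ k c (f : ℕ → ℚ) n → shift k (λ m → c · f m) n ≡ c · shift k f n
shift-*ˡ k c f = shift-commute (λ g → c · g tt) (ℚ.*-zeroʳ c) k (λ _ → f)

shift-∑ : ∀ k N (F : ℕ → ℕ → ℚ) n → shift k (λ m → ∑ N (λ i → F i m)) n ≡ ∑ N (λ i → shift k (F i) n)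
shift-∑ k N = shift-commute (∑ N) (∑-zero N (λ _ _ → refl)) k

shift-sumℚ : ∀ {A : Set} k (xs : List A) (F : A → ℕ → ℚ) n →
             shift k (λ m → sumℚ (map (λ x → F x m) xs)) n ≡ sumℚ (map (λ x → shift k (F x) n) xs)
shift-sumℚ k xs = shift-commute (λ g → sumℚ (map g xs)) (sumℚ-zero xs) k

conv-δ : ∀ l (f : ℕ → ℚ) n → conv (δ l) f n ≡ shift l f n
conv-δ zero    f n       = begin
  1ℚ · f n + ∑ n (λ k → 0ℚ · f (n ∸ suc k))
    ≡⟨ cong₂ _+_ (ℚ.*-identityˡ (f n)) (∑-zero n (λ k _ → ℚ.*-zeroˡ (f (n ∸ suc k)))) ⟩
  f n + 0ℚ                                   ≡⟨ ℚ.+-identityʳ (f n) ⟩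
  f n                                        ∎
conv-δ (suc l) f zero    = trans (ℚ.+-identityʳ (0ℚ · f 0)) (ℚ.*-zeroˡ (f 0))
conv-δ (suc l) f (suc n) = begin
  0ℚ · f (suc n) + conv (δ l) f n   ≡⟨ cong (_+ conv (δ l) f n) (ℚ.*-zeroˡ (f (suc n))) ⟩
  0ℚ + conv (δ l) f n               ≡⟨ ℚ.+-identityˡ _ ⟩
  conv (δ l) f n                    ≡⟨ conv-δ l f n ⟩
  shift l f n                       ∎

conv-congˡ : ∀ n {f g h : ℕ → ℚ} → (∀ k → k ≤ n → f k ≡ g k) → conv f h n ≡ conv g h n
conv-congˡ n {h = h} eq = ∑-cong (suc n) (λ k k<1+n → cong (_· h (n ∸ k)) (eq k (ℕ.≤-pred k<1+n)))

conv-negˡ : ∀ (f g : ℕ → ℚ) n → conv (λ k → - f k) g n ≡ - conv f g n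
conv-negˡ f g n = trans (∑-cong (suc n) (λ k _ → sym (ℚ.neg-distribˡ-* (f k) (g (n ∸ k)))))
                        (∑-neg (suc n) (λ k → f k · g (n ∸ k)))

-- Reciprocal series

module _ (d : ℕ → ℚ) (n : ℕ) where
  -- invRev computes each new coefficient with a helper local to its where-block; unifying
  -- with the unfolding of invCoeff d (suc n) gives that helper the name next.
  mutual
    private
      next : ℕ → List ℚ → ℚ
      next = _

    private
      invCoeff-suc-next : invCoeff d (suc n) ≡ - next 0 (invRev d n)
      invCoeff-suc-next with 0 | invRev d n
      ... | _ | _ = refl

  private
    next-invRev : ∀ i m → next i (invRev d m) ≡ ∑ (suc m) (λ k → d (suc (i ℕ.+ k)) · invCoeff d (m ∸ k))
    next-invRev i zero    rewrite ℕ.+-identityʳ i = refl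
    next-invRev i (suc m) rewrite ℕ.+-identityʳ i =
      cong (d (suc i) · invCoeff d (suc m) +_) (trans (next-invRev (suc i) m)
        (∑-cong (suc m) (λ k _ → cong (λ j → d (suc j) · invCoeff d (m ∸ k)) (sym (ℕ.+-suc i k)))))

  invCoeff-suc : invCoeff d (suc n) ≡ - conv (d ∘ suc) (invCoeff d) n
  invCoeff-suc = trans invCoeff-suc-next (cong -_ (next-invRev 0 n))

invCoeff-unique : ∀ d (b : ℕ → ℚ) N → b 0 ≡ 1ℚ → (∀ j → j < N → b (suc j) ≡ - conv (d ∘ suc) b j) →
                  ∀ n → n ≤ N → b n ≡ invCoeff d n
invCoeff-unique d b zero    b0 rec zero z≤n = b0
invCoeff-unique d b (suc N) b0 rec = extend (invCoeff-unique d b N b0 (λ j j<N → rec j (ℕ.m<n⇒m<1+n j<N)))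
  where
  extend : (∀ n → n ≤ N → b n ≡ invCoeff d n) → ∀ n → n ≤ suc N → b n ≡ invCoeff d n
  extend agree n n≤1+N with ℕ.m≤n⇒m<n∨m≡n n≤1+N
  ... | inj₁ (s≤s n≤N) = agree n n≤N
  ... | inj₂ refl      = begin
    b (suc N)                          ≡⟨ rec N ℕ.≤-refl ⟩
    - conv (d ∘ suc) b N               ≡⟨ cong -_ (∑-cong (suc N) (λ k _ → cong (d (suc k) ·_) (agree (N ∸ k) (ℕ.m∸n≤m N k)))) ⟩
    - conv (d ∘ suc) (invCoeff d) N    ≡⟨ sym (invCoeff-suc d N) ⟩
    invCoeff d (suc N)                 ∎

invCoeff-dilate : ∀ k (d : ℕ → ℚ) → (∀ j → suc k ∤ j → d j ≡ 0ℚ) →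
                  ∀ q → invCoeff d (q * suc k) ≡ invCoeff (λ p → d (p * suc k)) q
invCoeff-dilate k d sparse q = invCoeff-unique _ (λ p → invCoeff d (p * suc k)) q refl step q ℕ.≤-refl
  where
  a = invCoeff d
  index : ∀ j p → k ℕ.+ j * suc k ∸ (p * suc k ℕ.+ k) ≡ (j ∸ p) * suc k
  index j p = begin
    k ℕ.+ j * suc k ∸ (p * suc k ℕ.+ k)     ≡⟨ cong (k ℕ.+ j * suc k ∸_) (ℕ.+-comm (p * suc k) k) ⟩
    k ℕ.+ j * suc k ∸ (k ℕ.+ p * suc k)     ≡⟨ ℕ.[m+n]∸[m+o]≡n∸o k (j * suc k) (p * suc k) ⟩
    j * suc k ∸ p * suc k                   ≡⟨ sym (ℕ.*-distribʳ-∸ (suc k) j p) ⟩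
    (j ∸ p) * suc k                         ∎
  step : ∀ j → j < q → a (suc j * suc k) ≡ - conv (λ p → d (suc p * suc k)) (λ p → a (p * suc k)) j
  step j _ = begin
    a (suc m)
      ≡⟨ invCoeff-suc d m ⟩
    - ∑ (suc j * suc k) (λ i → d (suc i) · a (m ∸ i))
      ≡⟨ cong -_ (∑-sparse k (suc j) _ (λ i k∤ → trans (cong (_· a (m ∸ i)) (sparse (suc i) k∤)) (ℚ.*-zeroˡ (a (m ∸ i))))) ⟩
    - ∑ (suc j) (λ p → d (suc (p * suc k ℕ.+ k)) · a (m ∸ (p * suc k ℕ.+ k)))
      ≡⟨ cong -_ (∑-cong (suc j) (λ p _ → cong₂ (λ i i′ → d i · a i′) (cong suc (ℕ.+-comm (p * suc k) k)) (index j p))) ⟩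
    - conv (λ p → d (suc p * suc k)) (λ p → a (p * suc k)) j
      ∎
    where m = k ℕ.+ j * suc k

-- Powers of Q = Σ_{l ∈ ls} x l · u^l: poly x ls are its coefficients, mulPoly x ls f is Q · f,
-- and power x ls s is Q^s, expanded by the binomial theorem in the first monomial of Q.

mulPoly : (ℕ → ℚ) → List ℕ → (ℕ → ℚ) → ℕ → ℚ
mulPoly x ls f n = sumℚ (map (λ l → x l · shift l f n) ls)

binomialTerm : ℚ → ℕ → (ℕ → ℕ → ℚ) → ℕ → ℕ → ℕ → ℚ
binomialTerm a l P s n t = ℕ→ℚ (s C t) · (pow a t · shift (l * t) (P (s ∸ t)) n)

power : (ℕ → ℚ) → List ℕ → ℕ → ℕ → ℚ
power x []       zero    n = δ 0 n
power x []       (suc s) n = 0ℚ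
power x (l ∷ ls) s       n = ∑ (suc s) (binomialTerm (x l) l (power x ls) s n)

poly : (ℕ → ℚ) → List ℕ → ℕ → ℚ
poly x ls k = sumℚ (map (λ l → δ l k · x l) ls)

shift-mulPoly : ∀ x ls k (f : ℕ → ℚ) n → shift k (mulPoly x ls f) n ≡ mulPoly x ls (shift k f) n
shift-mulPoly x ls k f n = begin
  shift k (λ m → sumℚ (map (λ l → x l · shift l f m) ls)) n   ≡⟨ shift-sumℚ k ls (λ l m → x l · shift l f m) n ⟩
  sumℚ (map (λ l → shift k (λ m → x l · shift l f m) n) ls)   ≡⟨ cong sumℚ (map-cong term ls) ⟩
  mulPoly x ls (shift k f) n                                  ∎
  where
  term : ∀ l → shift k (λ m → x l · shift l f m) n ≡ x l · shift l (shift k f) n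
  term l = trans (shift-*ˡ k (x l) (shift l f) n) (cong (x l ·_) (shift-comm k l f n))

mulPoly-*ˡ : ∀ x ls c (f : ℕ → ℚ) n → c · mulPoly x ls f n ≡ mulPoly x ls (λ m → c · f m) n
mulPoly-*ˡ x ls c f n = begin
  c · sumℚ (map (λ l → x l · shift l f n) ls)     ≡⟨ sym (sumℚ-*ˡ c (λ l → x l · shift l f n) ls) ⟩
  sumℚ (map (λ l → c · (x l · shift l f n)) ls)   ≡⟨ cong sumℚ (map-cong term ls) ⟩
  mulPoly x ls (λ m → c · f m) n                  ∎
  where
  term : ∀ l → c · (x l · shift l f n) ≡ x l · shift l (λ m → c · f m) n
  term l = trans (solve 3 (λ c a z → c :* (a :* z) := a :* (c :* z)) refl c (x l) (shift l f n))
                 (cong (x l ·_) (sym (shift-*ˡ l c f n)))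

mulPoly-∑ : ∀ x ls N (F : ℕ → ℕ → ℚ) n →
            ∑ N (λ i → mulPoly x ls (F i) n) ≡ mulPoly x ls (λ m → ∑ N (λ i → F i m)) n
mulPoly-∑ x ls N F n = begin
  ∑ N (λ i → sumℚ (map (λ l → x l · shift l (F i) n) ls))   ≡⟨ ∑-sumℚ N (λ i l → x l · shift l (F i) n) ls ⟩
  sumℚ (map (λ l → ∑ N (λ i → x l · shift l (F i) n)) ls)   ≡⟨ cong sumℚ (map-cong term ls) ⟩
  mulPoly x ls (λ m → ∑ N (λ i → F i m)) n                  ∎
  where
  term : ∀ l → ∑ N (λ i → x l · shift l (F i) n) ≡ x l · shift l (λ m → ∑ N (λ i → F i m)) n
  term l = trans (∑-*ˡ N (x l) (λ i → shift l (F i) n)) (cong (x l ·_) (sym (shift-∑ l N F n)))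

mulPoly-cong : ∀ x ls → All (1 ≤_) ls → ∀ {j} {f g : ℕ → ℚ} → (∀ m → m ≤ j → f m ≡ g m) →
               mulPoly x ls f (suc j) ≡ mulPoly x ls g (suc j)
mulPoly-cong x ls ls≥1 {j} {f} {g} eq =
  cong sumℚ (map-cong-local (All.map (λ {l} 1≤l → cong (x l ·_) (shift-suc-cong l 1≤l)) ls≥1))
  where
  shift-suc-cong : ∀ l → 1 ≤ l → shift l f (suc j) ≡ shift l g (suc j)
  shift-suc-cong (suc l) _ = shift-cong l eq

mulPoly-conv : ∀ x ls → All (1 ≤_) ls → ∀ (f : ℕ → ℚ) j → mulPoly x ls f (suc j) ≡ conv (poly x ls ∘ suc) f j
mulPoly-conv x ls ls≥1 f j = sym (begin
  ∑ (suc j) (λ k → sumℚ (map (λ l → δ l (suc k) · x l) ls) · f (j ∸ k))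
    ≡⟨ ∑-cong (suc j) (λ k _ → sym (sumℚ-*ʳ (f (j ∸ k)) (λ l → δ l (suc k) · x l) ls)) ⟩
  ∑ (suc j) (λ k → sumℚ (map (λ l → δ l (suc k) · x l · f (j ∸ k)) ls))
    ≡⟨ ∑-sumℚ (suc j) (λ k l → δ l (suc k) · x l · f (j ∸ k)) ls ⟩
  sumℚ (map (λ l → ∑ (suc j) (λ k → δ l (suc k) · x l · f (j ∸ k))) ls)
    ≡⟨ cong sumℚ (map-cong-local (All.map (λ {l} 1≤l → term l 1≤l) ls≥1)) ⟩
  mulPoly x ls f (suc j) ∎)
  where
  term : ∀ l → 1 ≤ l → ∑ (suc j) (λ k → δ l (suc k) · x l · f (j ∸ k)) ≡ x l · shift l f (suc j)
  term (suc l) _ = begin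
    ∑ (suc j) (λ k → δ l k · x (suc l) · f (j ∸ k))
      ≡⟨ ∑-cong (suc j) (λ k _ → solve 3 (λ d a b → d :* a :* b := a :* (d :* b)) refl (δ l k) (x (suc l)) (f (j ∸ k))) ⟩
    ∑ (suc j) (λ k → x (suc l) · (δ l k · f (j ∸ k)))
      ≡⟨ ∑-*ˡ (suc j) (x (suc l)) (λ k → δ l k · f (j ∸ k)) ⟩
    x (suc l) · conv (δ l) f j
      ≡⟨ cong (x (suc l) ·_) (conv-δ l f j) ⟩
    x (suc l) · shift l f j
      ∎

k>n⇒nCk·z≡0 : ∀ {s t} (z : ℚ) → s < t → ℕ→ℚ (s C t) · z ≡ 0ℚ
k>n⇒nCk·z≡0 z s<t = trans (cong (λ c → ℕ→ℚ c · z) (k>n⇒nCk≡0 s<t)) (ℚ.*-zeroˡ z)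

binomialTerm-vanish : ∀ a l P s n t → shift (l * t) (P (s ∸ t)) n ≡ 0ℚ → binomialTerm a l P s n t ≡ 0ℚ
binomialTerm-vanish a l P s n t eq = begin
  ℕ→ℚ (s C t) · (pow a t · shift (l * t) (P (s ∸ t)) n)   ≡⟨ cong (λ z → ℕ→ℚ (s C t) · (pow a t · z)) eq ⟩
  ℕ→ℚ (s C t) · (pow a t · 0ℚ)                            ≡⟨ cong (ℕ→ℚ (s C t) ·_) (ℚ.*-zeroʳ (pow a t)) ⟩
  ℕ→ℚ (s C t) · 0ℚ                                        ≡⟨ ℚ.*-zeroʳ (ℕ→ℚ (s C t)) ⟩
  0ℚ                                                      ∎

binomialTerm-range : ∀ a l P s n N → 1 ≤ l → n ≤ N →
                     ∑ (suc N) (binomialTerm a l P s n) ≡ ∑ (suc s) (binomialTerm a l P s n)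
binomialTerm-range a l P s n N 1≤l n≤N = begin
  ∑ (suc N) B              ≡⟨ sym (∑-extend (ℕ.m≤m+n (suc N) (suc s)) beyond-n) ⟩
  ∑ (suc N ℕ.+ suc s) B    ≡⟨ cong (λ k → ∑ k B) (ℕ.+-comm (suc N) (suc s)) ⟩
  ∑ (suc s ℕ.+ suc N) B    ≡⟨ ∑-extend (ℕ.m≤m+n (suc s) (suc N)) beyond-s ⟩
  ∑ (suc s) B              ∎
  where
  B = binomialTerm a l P s n
  beyond-s : ∀ t → suc s ≤ t → B t ≡ 0ℚ
  beyond-s t = k>n⇒nCk·z≡0 (pow a t · shift (l * t) (P (s ∸ t)) n)
  beyond-n : ∀ t → suc N ≤ t → B t ≡ 0ℚ
  beyond-n t N<t = binomialTerm-vanish a l P s n t (shift-below (P (s ∸ t))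
    (ℕ.<-≤-trans (ℕ.<-≤-trans (s≤s n≤N) N<t) (ℕ.m≤n*m t l {{ℕ.>-nonZero 1≤l}})))

shift-binomialTerm : ∀ k a l P s t n →
  shift k (λ m → binomialTerm a l P s m t) n ≡ ℕ→ℚ (s C t) · (pow a t · shift k (shift (l * t) (P (s ∸ t))) n)
shift-binomialTerm k a l P s t n =
  trans (shift-*ˡ k (ℕ→ℚ (s C t)) _ n) (cong (ℕ→ℚ (s C t) ·_) (shift-*ˡ k (pow a t) _ n))

sumℚ-binomialTerm : ∀ {A : Set} a l s n t (F : A → ℕ → ℕ → ℚ) xs →
  sumℚ (map (λ z → binomialTerm a l (F z) s n t) xs) ≡ binomialTerm a l (λ r m → sumℚ (map (λ z → F z r m) xs)) s n t
sumℚ-binomialTerm a l s n t F xs = begin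
  sumℚ (map (λ z → c · (p · shift (l * t) (F z (s ∸ t)) n)) xs)   ≡⟨ sumℚ-*ˡ c _ xs ⟩
  c · sumℚ (map (λ z → p · shift (l * t) (F z (s ∸ t)) n) xs)     ≡⟨ cong (c ·_) (sumℚ-*ˡ p _ xs) ⟩
  c · (p · sumℚ (map (λ z → shift (l * t) (F z (s ∸ t)) n) xs))
    ≡⟨ cong (λ w → c · (p · w)) (sym (shift-sumℚ (l * t) xs (λ z → F z (s ∸ t)) n)) ⟩
  binomialTerm a l (λ r m → sumℚ (map (λ z → F z r m) xs)) s n t  ∎
  where
  c = ℕ→ℚ (s C t)
  p = pow a t

power-zero : ∀ x ls n → power x ls 0 n ≡ δ 0 n
power-zero x []       n = refl
power-zero x (l ∷ ls) n = begin
  1ℚ · (1ℚ · shift (l * 0) (power x ls 0) n) + 0ℚ   ≡⟨ ℚ.+-identityʳ _ ⟩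
  1ℚ · (1ℚ · shift (l * 0) (power x ls 0) n)         ≡⟨ trans (ℚ.*-identityˡ _) (ℚ.*-identityˡ _) ⟩
  shift (l * 0) (power x ls 0) n                      ≡⟨ cong (λ k → shift k (power x ls 0) n) (ℕ.*-zeroʳ l) ⟩
  power x ls 0 n                                      ≡⟨ power-zero x ls n ⟩
  δ 0 n                                               ∎

power-vanish : ∀ x ls → All (1 ≤_) ls → ∀ s n → n < s → power x ls s n ≡ 0ℚ
power-vanish x []       []           (suc s) n _   = refl
power-vanish x (l ∷ ls) (1≤l ∷ ls≥1) s       n n<s = ∑-zero (suc s) (λ t t≤s →
  binomialTerm-vanish (x l) l (power x ls) s n t
    (shift-vanish (l * t) (power-vanish x ls ls≥1 (s ∸ t)) (bound t (ℕ.≤-pred t≤s))))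
  where
  bound : ∀ t → t ≤ s → n < l * t ℕ.+ (s ∸ t)
  bound t t≤s = ℕ.<-≤-trans n<s (subst (_≤ l * t ℕ.+ (s ∸ t)) (ℕ.m+[n∸m]≡n t≤s)
                  (ℕ.+-monoˡ-≤ (s ∸ t) (ℕ.m≤n*m t l {{ℕ.>-nonZero 1≤l}})))

-- For Q = a u^l + Q′ and P r = Q′^r these give, with Pascal's rule, the two halves of Q^{s+1} = Q · Q^s.
binomial-times-head : ∀ a l P s n →
  ∑ (suc s) (λ t → ℕ→ℚ (s C t) · (pow a (suc t) · shift (l * suc t) (P (s ∸ t)) n))
    ≡ a · shift l (λ m → ∑ (suc s) (binomialTerm a l P s m)) n
binomial-times-head a l P s n = begin
  ∑ (suc s) (λ t → ℕ→ℚ (s C t) · (pow a (suc t) · shift (l * suc t) (P (s ∸ t)) n))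
    ≡⟨ ∑-cong (suc s) (λ t _ → term t) ⟩
  ∑ (suc s) (λ t → a · shift l (λ m → binomialTerm a l P s m t) n)
    ≡⟨ ∑-*ˡ (suc s) a (λ t → shift l (λ m → binomialTerm a l P s m t) n) ⟩
  a · ∑ (suc s) (λ t → shift l (λ m → binomialTerm a l P s m t) n)
    ≡⟨ cong (a ·_) (sym (shift-∑ l (suc s) (λ t m → binomialTerm a l P s m t) n)) ⟩
  a · shift l (λ m → ∑ (suc s) (binomialTerm a l P s m)) n
    ∎
  where
  term : ∀ t → ℕ→ℚ (s C t) · (pow a (suc t) · shift (l * suc t) (P (s ∸ t)) n)
               ≡ a · shift l (λ m → binomialTerm a l P s m t) n
  term t = begin
    c · (a · p · shift (l * suc t) g n)           ≡⟨ cong (λ k → c · (a · p · shift k g n)) (ℕ.*-suc l t) ⟩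
    c · (a · p · shift (l ℕ.+ l * t) g n)         ≡⟨ cong (λ z → c · (a · p · z)) (shift-+ l (l * t) g n) ⟩
    c · (a · p · shift l (shift (l * t) g) n)     ≡⟨ solve 4 (λ c a p z → c :* (a :* p :* z) := a :* (c :* (p :* z))) refl c a p _ ⟩
    a · (c · (p · shift l (shift (l * t) g) n))   ≡⟨ cong (a ·_) (sym (shift-binomialTerm l a l P s t n)) ⟩
    a · shift l (λ m → binomialTerm a l P s m t) n ∎
    where
    c = ℕ→ℚ (s C t)
    p = pow a t
    g = P (s ∸ t)

binomial-times-tail : ∀ x ls a l (P : ℕ → ℕ → ℚ) s n → (∀ r m → P (suc r) m ≡ mulPoly x ls (P r) m) →
  ∑ (suc (suc s)) (λ t → ℕ→ℚ (s C t) · (pow a t · shift (l * t) (P (suc s ∸ t)) n))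
    ≡ mulPoly x ls (λ m → ∑ (suc s) (binomialTerm a l P s m)) n
binomial-times-tail x ls a l P s n P-suc = begin
  ∑ (suc (suc s)) h                     ≡⟨ ∑-snoc (suc s) h ⟩
  ∑ (suc s) h + h (suc s)
    ≡⟨ cong (∑ (suc s) h +_) (k>n⇒nCk·z≡0 (pow a (suc s) · shift (l * suc s) (P (s ∸ s)) n) (ℕ.n<1+n s)) ⟩
  ∑ (suc s) h + 0ℚ                      ≡⟨ ℚ.+-identityʳ _ ⟩
  ∑ (suc s) h                           ≡⟨ ∑-cong (suc s) (λ t t≤s → term t (ℕ.≤-pred t≤s)) ⟩
  ∑ (suc s) (λ t → mulPoly x ls (λ m → binomialTerm a l P s m t) n)
                                        ≡⟨ mulPoly-∑ x ls (suc s) (λ t m → binomialTerm a l P s m t) n ⟩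
  mulPoly x ls (λ m → ∑ (suc s) (binomialTerm a l P s m)) n ∎
  where
  h = λ t → ℕ→ℚ (s C t) · (pow a t · shift (l * t) (P (suc s ∸ t)) n)
  term : ∀ t → t ≤ s → h t ≡ mulPoly x ls (λ m → binomialTerm a l P s m t) n
  term t t≤s = begin
    c · (p · shift (l * t) (P (suc s ∸ t)) n)        ≡⟨ cong (λ r → c · (p · shift (l * t) (P r) n)) (ℕ.+-∸-assoc 1 t≤s) ⟩
    c · (p · shift (l * t) (P (suc (s ∸ t))) n)      ≡⟨ cong (λ z → c · (p · z)) (shift-cong (l * t) (λ m _ → P-suc (s ∸ t) m)) ⟩
    c · (p · shift (l * t) (mulPoly x ls g) n)       ≡⟨ cong (λ z → c · (p · z)) (shift-mulPoly x ls (l * t) g n) ⟩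
    c · (p · mulPoly x ls (shift (l * t) g) n)       ≡⟨ cong (c ·_) (mulPoly-*ˡ x ls p (shift (l * t) g) n) ⟩
    c · mulPoly x ls (λ m → p · shift (l * t) g m) n ≡⟨ mulPoly-*ˡ x ls c _ n ⟩
    mulPoly x ls (λ m → binomialTerm a l P s m t) n  ∎
    where
    c = ℕ→ℚ (s C t)
    p = pow a t
    g = P (s ∸ t)

power-suc : ∀ x ls s n → power x ls (suc s) n ≡ mulPoly x ls (power x ls s) n
power-suc x []       s n = refl
power-suc x (l ∷ ls) s n = begin
  B (suc s) 0 + ∑ (suc s) (λ t → B (suc s) (suc t))
    ≡⟨ cong (B (suc s) 0 +_) (trans (∑-cong (suc s) (λ t _ → pascal t)) (∑-+ (suc s) lower upper)) ⟩
  B (suc s) 0 + (∑ (suc s) lower + ∑ (suc s) upper)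
    -- B (suc s) 0 + ∑ (suc s) upper is the sum in binomial-times-tail, as s C 0 and suc s C 0 both compute to 1.
    ≡⟨ solve 3 (λ a b c → a :+ (b :+ c) := b :+ (a :+ c)) refl (B (suc s) 0) (∑ (suc s) lower) (∑ (suc s) upper) ⟩
  ∑ (suc s) lower + (B (suc s) 0 + ∑ (suc s) upper)
    ≡⟨ cong₂ _+_ (binomial-times-head a l P s n) (binomial-times-tail x ls a l P s n (power-suc x ls)) ⟩
  a · shift l (power x (l ∷ ls) s) n + mulPoly x ls (power x (l ∷ ls) s) n
    ∎
  where
  a = x l
  P = power x ls
  B : ℕ → ℕ → ℚ
  B s′ = binomialTerm a l P s′ n
  term : ℕ → ℚ
  term t = pow a (suc t) · shift (l * suc t) (P (s ∸ t)) n
  lower upper : ℕ → ℚ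
  lower t = ℕ→ℚ (s C t) · term t
  upper t = ℕ→ℚ (s C suc t) · term t
  pascal : ∀ t → B (suc s) (suc t) ≡ lower t + upper t
  pascal t = trans (cong (_· term t) (trans (cong ℕ→ℚ (sym (nCk+nC[k+1]≡[n+1]C[k+1] s t))) (ℕ→ℚ-homo-+ (s C t) (s C suc t))))
                   (ℚ.*-distribʳ-+ (term t) (ℕ→ℚ (s C t)) (ℕ→ℚ (s C suc t)))

geometric : (ℕ → ℚ) → List ℕ → ℕ → ℚ
geometric x ls n = ∑ (suc n) (λ s → power x ls s n)

geometric-zero : ∀ x ls → geometric x ls 0 ≡ 1ℚ
geometric-zero x ls = trans (ℚ.+-identityʳ (power x ls 0 0)) (power-zero x ls 0)

geometric-suc : ∀ x ls → All (1 ≤_) ls → ∀ j → geometric x ls (suc j) ≡ mulPoly x ls (geometric x ls) (suc j)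
geometric-suc x ls ls≥1 j = begin
  power x ls 0 (suc j) + ∑ (suc j) (λ s → power x ls (suc s) (suc j))
    ≡⟨ cong₂ _+_ (power-zero x ls (suc j)) (∑-cong (suc j) (λ s _ → power-suc x ls s (suc j))) ⟩
  0ℚ + ∑ (suc j) (λ s → mulPoly x ls (power x ls s) (suc j))
    ≡⟨ ℚ.+-identityˡ _ ⟩
  ∑ (suc j) (λ s → mulPoly x ls (power x ls s) (suc j))
    ≡⟨ mulPoly-∑ x ls (suc j) (power x ls) (suc j) ⟩
  mulPoly x ls (λ m → ∑ (suc j) (λ s → power x ls s m)) (suc j)
    ≡⟨ mulPoly-cong x ls ls≥1 (λ m m≤j → ∑-extend (s≤s m≤j) (λ s → power-vanish x ls ls≥1 s m)) ⟩
  mulPoly x ls (geometric x ls) (suc j)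
    ∎

-- Multinomial sums over tuples; compSum ls is multinomialSum termWeight ls by unfolding.

monomial : (ℕ → ℚ) → List ℕ → List ℕ → ℚ
monomial x ls ts = productℚ (zipWith (λ l t → pow (x l) t) ls ts)

multinomialTerm : (ℕ → ℚ) → List ℕ → ℕ → List ℕ → ℚ
multinomialTerm x ls n ts = if weight ls ts ≡ᵇ n then ℕ→ℚ (multinomial ts) · monomial x ls ts else 0ℚ

multinomialSum : (ℕ → ℚ) → List ℕ → ℕ → ℚ
multinomialSum x ls n = sumℚ (map (multinomialTerm x ls n) (tuples (length ls) n))

termWeight : ℕ → ℚ
termWeight l = - inv! (3 * l)

-- The multinomial coefficient of t ∷ ts involves the size of ts, so terms are split by size.
sizedTerm : (ℕ → ℚ) → List ℕ → ℕ → List ℕ → ℕ → ℚ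
sizedTerm x ls s ts n = δ s (sum ts) · multinomialTerm x ls n ts

if-≢ : ∀ {a b} (A : ℚ) → a ≢ b → (if a ≡ᵇ b then A else 0ℚ) ≡ 0ℚ
if-≢ {zero}  {zero}  A a≢b = contradiction refl a≢b
if-≢ {zero}  {suc b} A a≢b = refl
if-≢ {suc a} {zero}  A a≢b = refl
if-≢ {suc a} {suc b} A a≢b = if-≢ A (a≢b ∘ cong suc)

δ-binomial : ∀ s t σ → δ s (t ℕ.+ σ) · ℕ→ℚ ((t ℕ.+ σ) C t) ≡ ℕ→ℚ (s C t) · δ (s ∸ t) σ
δ-binomial s t σ with t ≤? s
... | no t≰s = begin
  δ s (t ℕ.+ σ) · ℕ→ℚ ((t ℕ.+ σ) C t)
    ≡⟨ cong (_· ℕ→ℚ ((t ℕ.+ σ) C t)) (δ-≢ (ℕ.<⇒≢ (ℕ.<-≤-trans s<t (ℕ.m≤m+n t σ)))) ⟩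
  0ℚ · ℕ→ℚ ((t ℕ.+ σ) C t)              ≡⟨ ℚ.*-zeroˡ (ℕ→ℚ ((t ℕ.+ σ) C t)) ⟩
  0ℚ                                    ≡⟨ sym (k>n⇒nCk·z≡0 (δ (s ∸ t) σ) s<t) ⟩
  ℕ→ℚ (s C t) · δ (s ∸ t) σ             ∎
  where s<t = ℕ.≰⇒> t≰s
... | yes t≤s = begin
  δ s (t ℕ.+ σ) · ℕ→ℚ ((t ℕ.+ σ) C t)   ≡⟨ cong (λ s′ → δ s′ (t ℕ.+ σ) · ℕ→ℚ ((t ℕ.+ σ) C t)) (sym s≡t+r) ⟩
  δ (t ℕ.+ r) (t ℕ.+ σ) · ℕ→ℚ ((t ℕ.+ σ) C t)
                                        ≡⟨ cong (_· ℕ→ℚ ((t ℕ.+ σ) C t)) (δ-cancel t r σ) ⟩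
  δ r σ · ℕ→ℚ ((t ℕ.+ σ) C t)           ≡⟨ δ-subst r σ (λ i → ℕ→ℚ ((t ℕ.+ i) C t)) ⟩
  δ r σ · ℕ→ℚ ((t ℕ.+ r) C t)           ≡⟨ ℚ.*-comm (δ r σ) _ ⟩
  ℕ→ℚ ((t ℕ.+ r) C t) · δ r σ           ≡⟨ cong (λ s′ → ℕ→ℚ (s′ C t) · δ r σ) s≡t+r ⟩
  ℕ→ℚ (s C t) · δ r σ                   ∎
  where
  r = s ∸ t
  s≡t+r = ℕ.m+[n∸m]≡n t≤s

δ-multinomial-cons : ∀ s t σ μ p π →
  δ s (t ℕ.+ σ) · (ℕ→ℚ (((t ℕ.+ σ) C t) * μ) · (p · π)) ≡ ℕ→ℚ (s C t) · (p · (δ (s ∸ t) σ · (ℕ→ℚ μ · π)))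
δ-multinomial-cons s t σ μ p π = begin
  δ s (t ℕ.+ σ) · (ℕ→ℚ (((t ℕ.+ σ) C t) * μ) · (p · π))
    ≡⟨ cong (λ z → δ s (t ℕ.+ σ) · (z · (p · π))) (ℕ→ℚ-homo-* ((t ℕ.+ σ) C t) μ) ⟩
  δ s (t ℕ.+ σ) · (ℕ→ℚ ((t ℕ.+ σ) C t) · ℕ→ℚ μ · (p · π))
    ≡⟨ solve 5 (λ d b m p π → d :* (b :* m :* (p :* π)) := d :* b :* (p :* (m :* π))) refl
         (δ s (t ℕ.+ σ)) (ℕ→ℚ ((t ℕ.+ σ) C t)) (ℕ→ℚ μ) p π ⟩
  δ s (t ℕ.+ σ) · ℕ→ℚ ((t ℕ.+ σ) C t) · (p · (ℕ→ℚ μ · π))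
    ≡⟨ cong (_· (p · (ℕ→ℚ μ · π))) (δ-binomial s t σ) ⟩
  ℕ→ℚ (s C t) · δ (s ∸ t) σ · (p · (ℕ→ℚ μ · π))
    ≡⟨ solve 5 (λ c d p m π → c :* d :* (p :* (m :* π)) := c :* (p :* (d :* (m :* π)))) refl
         (ℕ→ℚ (s C t)) (δ (s ∸ t) σ) p (ℕ→ℚ μ) π ⟩
  ℕ→ℚ (s C t) · (p · (δ (s ∸ t) σ · (ℕ→ℚ μ · π)))
    ∎

sizedTerm-cons : ∀ x l ls s t ts n →
  sizedTerm x (l ∷ ls) s (t ∷ ts) n ≡ binomialTerm (x l) l (λ r → sizedTerm x ls r ts) s n t
sizedTerm-cons x l ls s t ts n = begin
  δ s (t ℕ.+ σ) · (if l * t ℕ.+ w ≡ᵇ n then ℕ→ℚ (((t ℕ.+ σ) C t) * μ) · (p · π) else 0ℚ)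
    ≡⟨ factor (l * t ℕ.+ w ≡ᵇ n) ⟩
  c · (p · (δ (s ∸ t) σ · (if l * t ℕ.+ w ≡ᵇ n then ℕ→ℚ μ · π else 0ℚ)))
    ≡⟨ cong (λ z → c · (p · (δ (s ∸ t) σ · z))) (sym (shift-if (l * t) w n (ℕ→ℚ μ · π))) ⟩
  c · (p · (δ (s ∸ t) σ · shift (l * t) (λ m → multinomialTerm x ls m ts) n))
    ≡⟨ cong (λ z → c · (p · z)) (sym (shift-*ˡ (l * t) (δ (s ∸ t) σ) (λ m → multinomialTerm x ls m ts) n)) ⟩
  binomialTerm (x l) l (λ r → sizedTerm x ls r ts) s n t
    ∎
  where
  σ = sum ts
  w = weight ls ts
  μ = multinomial ts
  π = monomial x ls ts
  p = pow (x l) t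
  c = ℕ→ℚ (s C t)
  factor : ∀ b → δ s (t ℕ.+ σ) · (if b then ℕ→ℚ (((t ℕ.+ σ) C t) * μ) · (p · π) else 0ℚ)
                 ≡ c · (p · (δ (s ∸ t) σ · (if b then ℕ→ℚ μ · π else 0ℚ)))
  factor true  = δ-multinomial-cons s t σ μ p π
  factor false = trans (ℚ.*-zeroʳ (δ s (t ℕ.+ σ)))
    (solve 3 (λ c p d → con 0ℚ := c :* (p :* (d :* con 0ℚ))) refl c p (δ (s ∸ t) σ))

sumℚ-tuples : ∀ k b (f : List ℕ → ℚ) →
  sumℚ (map f (tuples (suc k) b)) ≡ ∑ (suc b) (λ t → sumℚ (map (f ∘ (t ∷_)) (tuples k b)))
sumℚ-tuples k b f = begin
  sumℚ (map f (concatMap (λ t → map (t ∷_) (tuples k b)) (upTo (suc b))))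
    ≡⟨ sumℚ-concatMap f (λ t → map (t ∷_) (tuples k b)) (upTo (suc b)) ⟩
  sumℚ (map (λ t → sumℚ (map f (map (t ∷_) (tuples k b)))) (upTo (suc b)))
    ≡⟨ sumℚ-upTo (λ t → sumℚ (map f (map (t ∷_) (tuples k b)))) (suc b) ⟩
  ∑ (suc b) (λ t → sumℚ (map f (map (t ∷_) (tuples k b))))
    ≡⟨ ∑-cong (suc b) (λ t _ → cong sumℚ (sym (map-∘ {g = f} {f = t ∷_} (tuples k b)))) ⟩
  ∑ (suc b) (λ t → sumℚ (map (f ∘ (t ∷_)) (tuples k b)))
    ∎

tuples-length : ∀ k b → All (λ ts → length ts ≡ k) (tuples k b)
tuples-length zero    b = refl ∷ []
tuples-length (suc k) b = All.concat⁺ (All.map⁺ (All.applyUpTo⁺₂ (λ t → t) (suc b) (λ t →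
  All.map⁺ (All.map (cong suc) (tuples-length k b)))))

sum≤weight : ∀ ls ts → All (1 ≤_) ls → length ts ≡ length ls → sum ts ≤ weight ls ts
sum≤weight []       []       []           _  = z≤n
sum≤weight (l ∷ ls) (t ∷ ts) (1≤l ∷ ls≥1) eq =
  ℕ.+-mono-≤ (ℕ.m≤n*m t l {{ℕ.>-nonZero 1≤l}}) (sum≤weight ls ts ls≥1 (ℕ.suc-injective eq))

multinomialTerm-bySize : ∀ x ls n ts → All (1 ≤_) ls → length ts ≡ length ls →
  multinomialTerm x ls n ts ≡ ∑ (suc n) (λ s → sizedTerm x ls s ts n)
multinomialTerm-bySize x ls n ts ls≥1 len with sum ts ≤? n
... | yes σ≤n = sym (∑-δ (suc n) (sum ts) (λ _ → multinomialTerm x ls n ts) (s≤s σ≤n))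
... | no σ≰n = trans vanish (sym (∑-zero (suc n) (λ s _ →
                 trans (cong (δ s (sum ts) ·_) vanish) (ℚ.*-zeroʳ (δ s (sum ts))))))
  where
  vanish : multinomialTerm x ls n ts ≡ 0ℚ
  vanish = if-≢ (ℕ→ℚ (multinomial ts) · monomial x ls ts)
             (λ w≡n → σ≰n (subst (sum ts ≤_) w≡n (sum≤weight ls ts ls≥1 len)))

sumℚ-sizedTerm≡power : ∀ x ls → All (1 ≤_) ls → ∀ b s n → n ≤ b →
  sumℚ (map (λ ts → sizedTerm x ls s ts n) (tuples (length ls) b)) ≡ power x ls s n
sumℚ-sizedTerm≡power x []       []           b zero    zero    _   = refl
sumℚ-sizedTerm≡power x []       []           b zero    (suc n) _   = refl
sumℚ-sizedTerm≡power x []       []           b (suc s) zero    _   = refl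
sumℚ-sizedTerm≡power x []       []           b (suc s) (suc n) _   = refl
sumℚ-sizedTerm≡power x (l ∷ ls) (1≤l ∷ ls≥1) b s       n       n≤b = begin
  sumℚ (map (λ ts → sizedTerm x (l ∷ ls) s ts n) (tuples (suc (length ls)) b))
    ≡⟨ sumℚ-tuples (length ls) b (λ ts → sizedTerm x (l ∷ ls) s ts n) ⟩
  ∑ (suc b) (λ t → sumℚ (map (λ ts → sizedTerm x (l ∷ ls) s (t ∷ ts) n) T))
    ≡⟨ ∑-cong (suc b) (λ t _ → column t) ⟩
  ∑ (suc b) (binomialTerm (x l) l (power x ls) s n)
    ≡⟨ binomialTerm-range (x l) l (power x ls) s n b 1≤l n≤b ⟩
  power x (l ∷ ls) s n
    ∎
  where
  T = tuples (length ls) b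
  column : ∀ t → sumℚ (map (λ ts → sizedTerm x (l ∷ ls) s (t ∷ ts) n) T) ≡ binomialTerm (x l) l (power x ls) s n t
  column t = begin
    sumℚ (map (λ ts → sizedTerm x (l ∷ ls) s (t ∷ ts) n) T)
      ≡⟨ cong sumℚ (map-cong (λ ts → sizedTerm-cons x l ls s t ts n) T) ⟩
    sumℚ (map (λ ts → binomialTerm (x l) l (λ r → sizedTerm x ls r ts) s n t) T)
      ≡⟨ sumℚ-binomialTerm (x l) l s n t (λ ts r → sizedTerm x ls r ts) T ⟩
    binomialTerm (x l) l (λ r m → sumℚ (map (λ ts → sizedTerm x ls r ts m) T)) s n t
      ≡⟨ cong (λ z → ℕ→ℚ (s C t) · (pow (x l) t · z))
           (shift-cong (l * t) (λ m m≤n → sumℚ-sizedTerm≡power x ls ls≥1 b (s ∸ t) m (ℕ.≤-trans m≤n n≤b))) ⟩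
    binomialTerm (x l) l (power x ls) s n t
      ∎

multinomialSum≡geometric : ∀ x ls → All (1 ≤_) ls → ∀ n → multinomialSum x ls n ≡ geometric x ls n
multinomialSum≡geometric x ls ls≥1 n = begin
  sumℚ (map (multinomialTerm x ls n) T)
    ≡⟨ cong sumℚ (map-cong-local (All.map (λ {ts} len → multinomialTerm-bySize x ls n ts ls≥1 len) (tuples-length (length ls) n))) ⟩
  sumℚ (map (λ ts → ∑ (suc n) (λ s → sizedTerm x ls s ts n)) T)
    ≡⟨ sym (∑-sumℚ (suc n) (λ s ts → sizedTerm x ls s ts n) T) ⟩
  ∑ (suc n) (λ s → sumℚ (map (λ ts → sizedTerm x ls s ts n) T))
    ≡⟨ ∑-cong (suc n) (λ s _ → sumℚ-sizedTerm≡power x ls ls≥1 n s n ℕ.≤-refl) ⟩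
  geometric x ls n
    ∎
  where T = tuples (length ls) n

multinomialSum-zero : ∀ x ls → All (1 ≤_) ls → multinomialSum x ls 0 ≡ 1ℚ
multinomialSum-zero x ls ls≥1 = trans (multinomialSum≡geometric x ls ls≥1 0) (geometric-zero x ls)

multinomialSum-suc : ∀ x ls → All (1 ≤_) ls → ∀ j →
  multinomialSum x ls (suc j) ≡ conv (poly x ls ∘ suc) (multinomialSum x ls) j
multinomialSum-suc x ls ls≥1 j = begin
  multinomialSum x ls (suc j)                   ≡⟨ multinomialSum≡geometric x ls ls≥1 (suc j) ⟩
  geometric x ls (suc j)                             ≡⟨ geometric-suc x ls ls≥1 j ⟩
  mulPoly x ls (geometric x ls) (suc j)              ≡⟨ mulPoly-cong x ls ls≥1 (λ m _ → sym (multinomialSum≡geometric x ls ls≥1 m)) ⟩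
  mulPoly x ls (multinomialSum x ls) (suc j)    ≡⟨ mulPoly-conv x ls ls≥1 (multinomialSum x ls) j ⟩
  conv (poly x ls ∘ suc) (multinomialSum x ls) j ∎

-- The two denominators

poly-range-offset : ∀ x a b j → poly x (range a b) (a ℕ.+ j) ≡ ∑ (suc b ∸ a) (λ i → δ i j · x (a ℕ.+ i))
poly-range-offset x a b j = trans (sumℚ-range (λ l → δ l (a ℕ.+ j) · x l) a b)
  (∑-cong (suc b ∸ a) (λ i _ → cong (_· x (a ℕ.+ i)) (δ-cancel a i j)))

poly-range-hit : ∀ x {a b l} → a ≤ l → l ≤ b → poly x (range a b) l ≡ x l
poly-range-hit x {a} {b} {l} a≤l l≤b = begin
  poly x (range a b) l                          ≡⟨ cong (poly x (range a b)) (sym l≡a+j) ⟩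
  poly x (range a b) (a ℕ.+ j)                  ≡⟨ poly-range-offset x a b j ⟩
  ∑ (suc b ∸ a) (λ i → δ i j · x (a ℕ.+ i))     ≡⟨ ∑-δ (suc b ∸ a) j (x ∘ (a ℕ.+_)) (ℕ.∸-monoˡ-< (s≤s l≤b) a≤l) ⟩
  x (a ℕ.+ j)                                   ≡⟨ cong x l≡a+j ⟩
  x l                                           ∎
  where
  j = l ∸ a
  l≡a+j = ℕ.m+[n∸m]≡n a≤l

poly-range-above : ∀ x {a b l} → a ≤ l → b < l → poly x (range a b) l ≡ 0ℚ
poly-range-above x {a} {b} {l} a≤l b<l = begin
  poly x (range a b) l                          ≡⟨ cong (poly x (range a b)) (sym (ℕ.m+[n∸m]≡n a≤l)) ⟩
  poly x (range a b) (a ℕ.+ j)                  ≡⟨ poly-range-offset x a b j ⟩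
  ∑ (suc b ∸ a) (λ i → δ i j · x (a ℕ.+ i))     ≡⟨ ∑-δ-miss (suc b ∸ a) j (x ∘ (a ℕ.+_)) (ℕ.∸-monoˡ-≤ a b<l) ⟩
  0ℚ                                            ∎
  where j = l ∸ a

poly-range-below : ∀ x {a b l} → l < a → poly x (range a b) l ≡ 0ℚ
poly-range-below x {a} {b} {l} l<a = trans (sumℚ-range (λ l′ → δ l′ l · x l′) a b)
  (∑-zero (suc b ∸ a) (λ i _ → trans (cong (_· x (a ℕ.+ i)) (δ-≢ (ℕ.>⇒≢ (ℕ.<-≤-trans l<a (ℕ.m≤m+n a i)))))
                                     (ℚ.*-zeroˡ (x (a ℕ.+ i)))))

range-positive : ∀ a b → 1 ≤ a → All (1 ≤_) (range a b)
range-positive a b 1≤a = All.map⁺ (All.applyUpTo⁺₂ (λ i → i) (suc b ∸ a) (λ i → ℕ.≤-trans 1≤a (ℕ.m≤m+n a i)))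

Selects : (ℕ → ℚ) → List ℕ → (ℕ → Bool) → ℕ → Set
Selects x ls S n = ∀ l → 1 ≤ l → l ≤ n → poly x ls l ≡ (if S l then x l else 0ℚ)

range-selects-inLe : ∀ x m n → Selects x (range 1 m) (inLe m) n
range-selects-inLe x m n (suc q) _ _ = select (ℕ.≤ᵇ-reflects-≤ (suc q) m)
  where
  select : ∀ {b} → Reflects (suc q ≤ m) b → poly x (range 1 m) (suc q) ≡ (if b then x (suc q) else 0ℚ)
  select (ofʸ q<m) = poly-range-hit x (s≤s z≤n) q<m
  select (ofⁿ q≮m) = poly-range-above x (s≤s z≤n) (ℕ.≰⇒> q≮m)

range-selects-inGe : ∀ x m n → Selects x (range m n) (inGe m) n
range-selects-inGe x m n (suc q) _ q<n = trans (select (ℕ.≤ᵇ-reflects-≤ m (suc q)))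
  (cong (λ b → if b then x (suc q) else 0ℚ) (sym (∧-identityʳ (m ≤ᵇ suc q))))
  where
  select : ∀ {b} → Reflects (m ≤ suc q) b → poly x (range m n) (suc q) ≡ (if b then x (suc q) else 0ℚ)
  select (ofʸ m≤q) = poly-range-hit x m≤q q<n
  select (ofⁿ m≰q) = poly-range-below x (ℕ.≰⇒> m≰q)

denCoeff-sparse : ∀ S j → 3 ∤ j → denCoeff S j ≡ 0ℚ
denCoeff-sparse S zero    3∤0 = contradiction (3 ∣0) 3∤0
denCoeff-sparse S (suc j) 3∤j =
  cong (λ b → if b ∧ S (suc j / 3) then inv! (suc j) else 0ℚ) (nonzero (suc j % 3) (3∤j ∘ m%n≡0⇒n∣m (suc j) 3))
  where
  nonzero : ∀ r → r ≢ 0 → (r ≡ᵇ 0) ≡ false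
  nonzero zero    r≢0 = contradiction refl r≢0
  nonzero (suc r) _   = refl

denCoeff-dilated : ∀ S q → denCoeff S (suc q * 3) ≡ (if S (suc q) then inv! (suc q * 3) else 0ℚ)
denCoeff-dilated S q = cong₂ (λ r p → if (r ≡ᵇ 0) ∧ S p then inv! (suc q * 3) else 0ℚ) (m*n%n≡0 (suc q) 3) (m*n/n≡m (suc q) 3)

denCoeff-poly : ∀ S ls n → Selects termWeight ls S n →
                ∀ q → suc q ≤ n → denCoeff S (suc q * 3) ≡ - poly termWeight ls (suc q)
denCoeff-poly S ls n selects q q<n = begin
  denCoeff S (suc q * 3)                              ≡⟨ denCoeff-dilated S q ⟩
  (if S (suc q) then inv! (suc q * 3) else 0ℚ)        ≡⟨ negate (S (suc q)) ⟩
  - (if S (suc q) then termWeight (suc q) else 0ℚ)    ≡⟨ cong -_ (sym (selects (suc q) (s≤s z≤n) q<n)) ⟩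
  - poly termWeight ls (suc q)                        ∎
  where
  negate : ∀ b → (if b then inv! (suc q * 3) else 0ℚ) ≡ - (if b then termWeight (suc q) else 0ℚ)
  negate true  = trans (cong inv! (ℕ.*-comm (suc q) 3)) (sym (⁻¹-involutive (inv! (3 * suc q))))
  negate false = refl

invCoeff-denCoeff : ∀ S ls n → All (1 ≤_) ls → Selects termWeight ls S n →
                    invCoeff (denCoeff S) (3 * n) ≡ compSum ls n
invCoeff-denCoeff S ls n ls≥1 selects = begin
  invCoeff (denCoeff S) (3 * n)           ≡⟨ cong (invCoeff (denCoeff S)) (ℕ.*-comm 3 n) ⟩
  invCoeff (denCoeff S) (n * 3)           ≡⟨ invCoeff-dilate 2 (denCoeff S) (denCoeff-sparse S) n ⟩
  invCoeff (λ q → denCoeff S (q * 3)) n   ≡⟨ sym (invCoeff-unique _ K n K-zero recurrence n ℕ.≤-refl) ⟩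
  compSum ls n                            ∎
  where
  K = multinomialSum termWeight ls
  Q = poly termWeight ls
  K-zero = multinomialSum-zero termWeight ls ls≥1
  recurrence : ∀ j → j < n → K (suc j) ≡ - conv (λ k → denCoeff S (suc k * 3)) K j
  recurrence j j<n = begin
    K (suc j)                                  ≡⟨ multinomialSum-suc termWeight ls ls≥1 j ⟩
    conv (Q ∘ suc) K j                         ≡⟨ sym (⁻¹-involutive (conv (Q ∘ suc) K j)) ⟩
    - - conv (Q ∘ suc) K j                     ≡⟨ cong -_ (sym (conv-negˡ (Q ∘ suc) K j)) ⟩
    - conv (λ k → - Q (suc k)) K j             ≡⟨ cong -_ (conv-congˡ j {h = K} (λ k k≤j →
                                                    sym (denCoeff-poly S ls n selects k (ℕ.≤-<-trans k≤j j<n)))) ⟩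
    - conv (λ k → denCoeff S (suc k * 3)) K j  ∎

proposition4 : ∀ (m n : ℕ) → 1 ≤ m → m ≤ n →
    (W≤ m (3 * n) ≡ ℕ→ℚ ((3 * n) !) ℚ.* compSum (range 1 m) n)
    × (W≥ m (3 * n) ≡ ℕ→ℚ ((3 * n) !) ℚ.* compSum (range m n) n)
proposition4 m n 1≤m _ =
  cong (ℕ→ℚ ((3 * n) !) ·_)
    (invCoeff-denCoeff (inLe m) (range 1 m) n (range-positive 1 m ℕ.≤-refl) (range-selects-inLe termWeight m n)) ,
  cong (ℕ→ℚ ((3 * n) !) ·_)
    (invCoeff-denCoeff (inGe m) (range m n) n (range-positive m n 1≤m) (range-selects-inGe termWeight m n))
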